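{- Let $c(z)=\frac{1-\sqrt{1-4z}}{2z}=\sum_{n\ge0}\frac{1}{n+1}\binom{2n}{n}z^n$ be the generating function of the Catalan numbers, and for a parameter $r$ let $\boldsymbol{C}(r)$ be the infinite lower triangular matrix with entries $$\boldsymbol{C}(r)_{n,k}=[z^n]\,\frac{c(z)}{1-rzc(z)}\left(\frac{zc(z)}{1-rzc(z)}\right)^k\quad(n,k\ge0),$$ i.e. the Riordan array $\boldsymbol{C}(r)=\left(\frac{c(z)}{1-rzc(z)},\frac{zc(z)}{1-rzc(z)}\right)$, which equals $\boldsymbol{C}\boldsymbol{P}(r)$ where $\boldsymbol{C}=(c(z),zc(z))$ and $\boldsymbol{P}(r)_{n,k}=\binom{n}{k}r^{n-k}$. Then for all integers $0\le k\le n$, $$\boldsymbol{C}(r)_{n,k}=[z^{n-k}]\left(\frac{c(z)}{1-rzc(z)}\right)^{k+1}=\sum_{i=0}^{n-k}\frac{i+k+1}{n+1}\binom{2n-i-k}{n}\binom{i+k}{k}r^i.$$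
   Context: $[z^m]f(z)$ denotes the coefficient of $z^m$ in the formal power series $f(z)$. The Riordan array $(d(z),h(z))$ with $d(0)\neq0$, $h(0)=0$ is the lower triangular matrix with $(n,k)$ entry $[z^n]d(z)h(z)^k$. -}

module Defs where

open import Data.Nat as ℕ using (ℕ; zero; suc; _∸_)
open import Data.Nat.Combinatorics using (_C_)
open import Data.Integer using (+_)
open import Data.Rational using (ℚ; 0ℚ; 1ℚ; _+_; _*_; _/_)

-- Formal power series over ℚ, given by their coefficient sequence: f n = [z^n] f(z).
Series : Set
Series = ℕ → ℚ

sumTo : ℕ → (ℕ → ℚ) → ℚ
sumTo zero    f = f 0
sumTo (suc n) f = sumTo n f + f (suc n)

_^ℚ_ : ℚ → ℕ → ℚ
x ^ℚ zero  = 1ℚ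
x ^ℚ suc k = x * (x ^ℚ k)

oneS : Series
oneS zero    = 1ℚ
oneS (suc _) = 0ℚ

zS : Series
zS 1 = 1ℚ
zS _ = 0ℚ

scaleS : ℚ → Series → Series
scaleS r f n = r * f n

_⊛_ : Series → Series → Series
(f ⊛ g) n = sumTo n (λ i → f i * g (n ∸ i))

powS : Series → ℕ → Series
powS f zero    = oneS
powS f (suc k) = f ⊛ powS f k

coeff : ℕ → Series → ℚ
coeff n f = f n

-- 1/(1 - u) = Σ_m u^m, for a series u with u 0 = 0 (only m ≤ n contribute to [z^n])
geomS : Series → Series
geomS u n = sumTo n (λ m → powS u m n)

cS : Series
cS n = (+ ((2 ℕ.* n) C n)) / suc n

rzc : ℚ → Series
rzc r = scaleS r (zS ⊛ cS)

dS : ℚ → Series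
dS r = cS ⊛ geomS (rzc r)

hS : ℚ → Series
hS r = (zS ⊛ cS) ⊛ geomS (rzc r)

riordan : Series → Series → ℕ → ℕ → ℚ
riordan d h n k = coeff n (d ⊛ powS h k)

Cr : ℚ → ℕ → ℕ → ℚ
Cr r = riordan (dS r) (hS r)

closedForm : ℚ → ℕ → ℕ → ℚ
closedForm r n k =
  sumTo (n ∸ k) (λ i →
    ((+ ((i ℕ.+ k ℕ.+ 1) ℕ.* (((2 ℕ.* n) ∸ (i ℕ.+ k)) C n) ℕ.* ((i ℕ.+ k) C k))) / suc n)
    * (r ^ℚ i))

module Submission where

-- C(r) is the Riordan array (d, h) with u = r z c, G = 1/(1-u), d = c G and
-- h = z c G = z d, where c is the Catalan series.
--
-- * Finite sums, then the algebra of formal power series: the Cauchy product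
--   is a commutative, associative, bilinear product that commutes with the
--   shift f ↦ z f and with locally finite sums Σᵢ Fᵢ.
-- * Riordan arrays (d, z d): since d (z d)^k = z^k d^{k+1}, the entry (n, k) is
--   [z^{n-k}] d^{k+1}.  This is the first formula.
-- * Geometric series: if u = z v then G^{q+1} = Σᵢ binom(i+q, q) uⁱ, since both
--   sides solve X = G^q + u X, whose solution is unique.
-- * Powers of c: [z^m] c^{j+1} is the ballot number
--   b(m, j) = binom(2m+j, m) - binom(2m+j, m-1); the relation c^{j+1} = c^j + z c^{j+2}
--   becomes a Pascal-type recursion for b, which yields c^j c^l = c^{j+l}, and
--   (m+j+1) b(m, j) = (j+1) binom(2m+j, m).
-- * Hence d^{k+1} = c^{k+1} G^{k+1} = Σᵢ binom(i+k, k) rⁱ zⁱ c^{k+1+i}; reading off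
--   [z^{n-k}] and using the closed form of b gives the second formula.

open import Defs
open import Data.Nat as ℕ using (ℕ; zero; suc; _∸_; _≤_; _<_; z≤n; s≤s; _!)
import Data.Nat.Properties as ℕP
open import Data.Nat.DivMod using (m/n*n≡m)
open import Data.Nat.Tactic.RingSolver using (solve-∀)
open import Data.Nat.Combinatorics using (_C_; nCn≡1; nCk≡nC[n∸k]; nCk+nC[k+1]≡[n+1]C[k+1]; k![n∸k]!∣n!)
open import Data.Nat.Combinatorics.Specification using (nCk≡n!/k![n-k]!; k>n⇒nCk≡0)
import Data.Integer as ℤ
import Data.Integer.Properties as ℤP
open import Data.Rational using (ℚ; 0ℚ; 1ℚ; _+_; _*_; _-_; _/_; toℚᵘ)
import Data.Rational.Properties as ℚP
open import Data.Rational.Unnormalised as ℚᵘ using (mkℚᵘ; *≡*)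
import Data.Rational.Unnormalised.Properties as ℚᵘP
import Data.Rational.Solver as ℚSolver
open import Data.Product using (_×_; _,_)
open import Data.Sum using (inj₁; inj₂)
open import Function using (_∘_)
open import Relation.Nullary using (yes; no)
open import Relation.Binary.PropositionalEquality
import Relation.Binary.Reasoning.Setoid as SetoidReasoning
open ℚSolver.+-*-Solver using (solve; _:=_; _:+_; _:-_; _:*_)

sumTo-cong : ∀ n {f g : ℕ → ℚ} → (∀ i → i ≤ n → f i ≡ g i) → sumTo n f ≡ sumTo n g
sumTo-cong zero    f≗g = f≗g 0 z≤n
sumTo-cong (suc n) f≗g =
  cong₂ _+_ (sumTo-cong n (λ i i≤n → f≗g i (ℕP.m≤n⇒m≤1+n i≤n))) (f≗g (suc n) ℕP.≤-refl)

sumTo-+ : ∀ n (f g : ℕ → ℚ) → sumTo n (λ i → f i + g i) ≡ sumTo n f + sumTo n g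
sumTo-+ zero    f g = refl
sumTo-+ (suc n) f g =
  trans (cong (_+ (f (suc n) + g (suc n))) (sumTo-+ n f g))
        (interchange (sumTo n f) (sumTo n g) (f (suc n)) (g (suc n)))
  where
  interchange : ∀ a b c d → (a + b) + (c + d) ≡ (a + c) + (b + d)
  interchange = solve 4 (λ a b c d → (a :+ b) :+ (c :+ d) := (a :+ c) :+ (b :+ d)) refl

sumTo-*ˡ : ∀ n a (f : ℕ → ℚ) → sumTo n (λ i → a * f i) ≡ a * sumTo n f
sumTo-*ˡ zero    a f = refl
sumTo-*ˡ (suc n) a f = trans (cong (_+ (a * f (suc n))) (sumTo-*ˡ n a f))
                             (sym (ℚP.*-distribˡ-+ a (sumTo n f) (f (suc n))))

sumTo-zero : ∀ n (f : ℕ → ℚ) → (∀ i → i ≤ n → f i ≡ 0ℚ) → sumTo n f ≡ 0ℚ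
sumTo-zero zero    f f≡0 = f≡0 0 z≤n
sumTo-zero (suc n) f f≡0 =
  cong₂ _+_ (sumTo-zero n f (λ i i≤n → f≡0 i (ℕP.m≤n⇒m≤1+n i≤n))) (f≡0 (suc n) ℕP.≤-refl)

sumTo-unfoldˡ : ∀ n (f : ℕ → ℚ) → sumTo (suc n) f ≡ f 0 + sumTo n (f ∘ suc)
sumTo-unfoldˡ zero    f = refl
sumTo-unfoldˡ (suc n) f =
  trans (cong (_+ f (suc (suc n))) (sumTo-unfoldˡ n f)) (ℚP.+-assoc (f 0) _ _)

sumTo-reverse : ∀ n (f : ℕ → ℚ) → sumTo n f ≡ sumTo n (λ i → f (n ∸ i))
sumTo-reverse zero    f = refl
sumTo-reverse (suc n) f = begin
  sumTo n f + f (suc n)                   ≡⟨ ℚP.+-comm (sumTo n f) (f (suc n)) ⟩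
  f (suc n) + sumTo n f                   ≡⟨ cong (f (suc n) +_) (sumTo-reverse n f) ⟩
  f (suc n) + sumTo n (λ i → f (n ∸ i))   ≡⟨ sym (sumTo-unfoldˡ n (λ i → f (suc n ∸ i))) ⟩
  sumTo (suc n) (λ i → f (suc n ∸ i))     ∎
  where open ≡-Reasoning

sumTo-swap : ∀ n m (F : ℕ → ℕ → ℚ) →
  sumTo n (λ i → sumTo m (F i)) ≡ sumTo m (λ j → sumTo n (λ i → F i j))
sumTo-swap zero    m F = refl
sumTo-swap (suc n) m F =
  trans (cong (_+ sumTo m (F (suc n))) (sumTo-swap n m F)) (sym (sumTo-+ m _ _))

sumTo-extend : ∀ {p} n (f : ℕ → ℚ) → p ≤ n → (∀ i → p < i → f i ≡ 0ℚ) →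
  sumTo p f ≡ sumTo n f
sumTo-extend n f p≤n f≡0 with ℕP.m≤n⇒m<n∨m≡n p≤n
... | inj₂ refl = refl
sumTo-extend {p} (suc n) f _ f≡0 | inj₁ (s≤s p≤n) = begin
  sumTo p f              ≡⟨ sumTo-extend n f p≤n f≡0 ⟩
  sumTo n f              ≡⟨ sym (ℚP.+-identityʳ (sumTo n f)) ⟩
  sumTo n f + 0ℚ         ≡⟨ cong (sumTo n f +_) (sym (f≡0 (suc n) (s≤s p≤n))) ⟩
  sumTo (suc n) f        ∎
  where open ≡-Reasoning

module ≗-Reasoning = SetoidReasoning (ℕ →-setoid ℚ)

≗-refl : {f : Series} → f ≗ f
≗-refl n = refl

≗-sym : {f g : Series} → f ≗ g → g ≗ f
≗-sym f≗g n = sym (f≗g n)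

≗-trans : {f g h : Series} → f ≗ g → g ≗ h → f ≗ h
≗-trans f≗g g≗h n = trans (f≗g n) (g≗h n)

infixl 6 _+S_
_+S_ : Series → Series → Series
(f +S g) n = f n + g n

shift : Series → Series
shift f zero    = 0ℚ
shift f (suc n) = f n

shiftBy : ℕ → Series → Series
shiftBy zero    f = f
shiftBy (suc j) f = shift (shiftBy j f)

OrderAtLeast : ℕ → Series → Set
OrderAtLeast i f = ∀ n → n < i → f n ≡ 0ℚ

-- A family in which Fᵢ has order at least i; its sum Σᵢ Fᵢ is then defined,
-- since only F₀, …, Fₙ contribute to [zⁿ].
Summable : (ℕ → Series) → Set
Summable F = ∀ i → OrderAtLeast i (F i)

sumS : (ℕ → Series) → Series
sumS F n = sumTo n (λ i → F i n)

+S-cong : ∀ {f f′ g g′} → f ≗ f′ → g ≗ g′ → f +S g ≗ f′ +S g′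
+S-cong p q n = cong₂ _+_ (p n) (q n)

+S-assoc : ∀ f g h → (f +S g) +S h ≗ f +S (g +S h)
+S-assoc f g h n = ℚP.+-assoc (f n) (g n) (h n)

scale-cong : ∀ a {f g} → f ≗ g → scaleS a f ≗ scaleS a g
scale-cong a f≗g n = cong (a *_) (f≗g n)

scale-one : ∀ f → scaleS 1ℚ f ≗ f
scale-one f n = ℚP.*-identityˡ (f n)

shift-cong : ∀ {f g} → f ≗ g → shift f ≗ shift g
shift-cong f≗g zero    = refl
shift-cong f≗g (suc n) = f≗g n

shiftBy-cong : ∀ j {f g} → f ≗ g → shiftBy j f ≗ shiftBy j g
shiftBy-cong zero    f≗g = f≗g
shiftBy-cong (suc j) f≗g = shift-cong (shiftBy-cong j f≗g)

shiftBy-order : ∀ j f → OrderAtLeast j (shiftBy j f)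
shiftBy-order (suc j) f zero    _          = refl
shiftBy-order (suc j) f (suc n) (s≤s n<j) = shiftBy-order j f n n<j

shiftBy-coeff : ∀ j f {n} → j ≤ n → shiftBy j f n ≡ f (n ∸ j)
shiftBy-coeff zero    f _         = refl
shiftBy-coeff (suc j) f (s≤s j≤n) = shiftBy-coeff j f j≤n

order-cong : ∀ {i f g} → f ≗ g → OrderAtLeast i f → OrderAtLeast i g
order-cong f≗g ord n n<i = trans (sym (f≗g n)) (ord n n<i)

scale-order : ∀ {i} a f → OrderAtLeast i f → OrderAtLeast i (scaleS a f)
scale-order a f ord n n<i = trans (cong (a *_) (ord n n<i)) (ℚP.*-zeroʳ a)

⊛-cong : ∀ {f f′ g g′} → f ≗ f′ → g ≗ g′ → f ⊛ g ≗ f′ ⊛ g′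
⊛-cong p q n = sumTo-cong n (λ i _ → cong₂ _*_ (p i) (q (n ∸ i)))

⊛-congʳ : ∀ f {g g′} → g ≗ g′ → f ⊛ g ≗ f ⊛ g′
⊛-congʳ f = ⊛-cong (≗-refl {f})

⊛-comm : ∀ f g → f ⊛ g ≗ g ⊛ f
⊛-comm f g n = begin
  sumTo n (λ i → f i * g (n ∸ i))               ≡⟨ sumTo-reverse n _ ⟩
  sumTo n (λ i → f (n ∸ i) * g (n ∸ (n ∸ i)))   ≡⟨ sumTo-cong n reflect ⟩
  sumTo n (λ i → g i * f (n ∸ i))               ∎
  where
  open ≡-Reasoning
  reflect : ∀ i → i ≤ n → f (n ∸ i) * g (n ∸ (n ∸ i)) ≡ g i * f (n ∸ i)
  reflect i i≤n = trans (cong (λ m → f (n ∸ i) * g m) (ℕP.m∸[m∸n]≡n i≤n)) (ℚP.*-comm (f (n ∸ i)) (g i))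

oneS-⊛ : ∀ f → oneS ⊛ f ≗ f
oneS-⊛ f zero    = ℚP.*-identityˡ (f 0)
oneS-⊛ f (suc n) = begin
  sumTo (suc n) (λ i → oneS i * f (suc n ∸ i))         ≡⟨ sumTo-unfoldˡ n _ ⟩
  1ℚ * f (suc n) + sumTo n (λ i → 0ℚ * f (n ∸ i))     ≡⟨ cong₂ _+_ (ℚP.*-identityˡ (f (suc n)))
                                                              (sumTo-zero n _ (λ i _ → ℚP.*-zeroˡ (f (n ∸ i)))) ⟩
  f (suc n) + 0ℚ                                        ≡⟨ ℚP.+-identityʳ _ ⟩
  f (suc n)                                             ∎
  where open ≡-Reasoning

⊛-oneS : ∀ f → f ⊛ oneS ≗ f
⊛-oneS f = ≗-trans (⊛-comm f oneS) (oneS-⊛ f)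

⊛-distribʳ : ∀ f g h → (f +S g) ⊛ h ≗ f ⊛ h +S g ⊛ h
⊛-distribʳ f g h n =
  trans (sumTo-cong n (λ i _ → ℚP.*-distribʳ-+ (h (n ∸ i)) (f i) (g i))) (sumTo-+ n _ _)

⊛-distribˡ : ∀ f g h → h ⊛ (f +S g) ≗ h ⊛ f +S h ⊛ g
⊛-distribˡ f g h n =
  trans (sumTo-cong n (λ i _ → ℚP.*-distribˡ-+ (h i) (f (n ∸ i)) (g (n ∸ i)))) (sumTo-+ n _ _)

scale-⊛ : ∀ a f g → scaleS a f ⊛ g ≗ scaleS a (f ⊛ g)
scale-⊛ a f g n = trans (sumTo-cong n (λ i _ → ℚP.*-assoc a (f i) (g (n ∸ i)))) (sumTo-*ˡ n a _)

⊛-scale : ∀ a f g → g ⊛ scaleS a f ≗ scaleS a (g ⊛ f)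
⊛-scale a f g n =
  trans (⊛-comm g (scaleS a f) n) (trans (scale-⊛ a f g n) (cong (a *_) (⊛-comm f g n)))

shift-⊛ : ∀ f g → shift f ⊛ g ≗ shift (f ⊛ g)
shift-⊛ f g zero    = ℚP.*-zeroˡ (g 0)
shift-⊛ f g (suc n) = begin
  sumTo (suc n) (λ i → shift f i * g (suc n ∸ i))    ≡⟨ sumTo-unfoldˡ n _ ⟩
  0ℚ * g (suc n) + (f ⊛ g) n                        ≡⟨ cong (_+ (f ⊛ g) n) (ℚP.*-zeroˡ (g (suc n))) ⟩
  0ℚ + (f ⊛ g) n                                    ≡⟨ ℚP.+-identityˡ _ ⟩
  (f ⊛ g) n                                         ∎
  where open ≡-Reasoning

⊛-shift : ∀ f g → g ⊛ shift f ≗ shift (g ⊛ f)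
⊛-shift f g = ≗-trans (⊛-comm g (shift f)) (≗-trans (shift-⊛ f g) (shift-cong (⊛-comm f g)))

⊛-shiftBy : ∀ j f g → g ⊛ shiftBy j f ≗ shiftBy j (g ⊛ f)
⊛-shiftBy zero    f g = ≗-refl
⊛-shiftBy (suc j) f g = ≗-trans (⊛-shift (shiftBy j f) g) (shift-cong (⊛-shiftBy j f g))

zS-⊛ : ∀ f → zS ⊛ f ≗ shift f
zS-⊛ f = ≗-trans (⊛-cong z≗shift-one (≗-refl {f})) (≗-trans (shift-⊛ oneS f) (shift-cong (oneS-⊛ f)))
  where
  z≗shift-one : zS ≗ shift oneS
  z≗shift-one zero          = refl
  z≗shift-one (suc zero)    = refl
  z≗shift-one (suc (suc n)) = refl

sumS-cong : ∀ {F G} → (∀ i → F i ≗ G i) → sumS F ≗ sumS G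
sumS-cong F≗G n = sumTo-cong n (λ i _ → F≗G i n)

sumS-unfold : ∀ F → Summable F → sumS F ≗ F 0 +S sumS (F ∘ suc)
sumS-unfold F summable n = begin
  sumTo n (λ i → F i n)                     ≡⟨ sumTo-extend (suc n) _ (ℕP.n≤1+n n) (λ i n<i → summable i n n<i) ⟩
  sumTo (suc n) (λ i → F i n)               ≡⟨ sumTo-unfoldˡ n _ ⟩
  F 0 n + sumTo n (λ i → F (suc i) n)       ∎
  where open ≡-Reasoning

⊛-sumS : ∀ f F → Summable F → f ⊛ sumS F ≗ sumS (λ i → f ⊛ F i)
⊛-sumS f F summable n = begin
  sumTo n (λ j → f j * sumTo (n ∸ j) (λ i → F i (n ∸ j)))
    ≡⟨ sumTo-cong n (λ j _ → cong (f j *_) (sumTo-extend n _ (ℕP.m∸n≤m n j) (λ i lt → summable i (n ∸ j) lt))) ⟩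
  sumTo n (λ j → f j * sumTo n (λ i → F i (n ∸ j)))
    ≡⟨ sumTo-cong n (λ j _ → sym (sumTo-*ˡ n (f j) _)) ⟩
  sumTo n (λ j → sumTo n (λ i → f j * F i (n ∸ j)))
    ≡⟨ sumTo-swap n n _ ⟩
  sumTo n (λ i → sumTo n (λ j → f j * F i (n ∸ j)))
    ∎
  where open ≡-Reasoning

⊛-as-sumS : ∀ f g → f ⊛ g ≗ sumS (λ j → scaleS (f j) (shiftBy j g))
⊛-as-sumS f g n = sumTo-cong n (λ j j≤n → cong (f j *_) (sym (shiftBy-coeff j g j≤n)))

shifts-summable : ∀ (w : ℕ → ℚ) g → Summable (λ j → scaleS (w j) (shiftBy j g))
shifts-summable w g j = scale-order (w j) (shiftBy j g) (shiftBy-order j g)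

-- Associativity: expand f g as Σⱼ fⱼ zʲ g and pull h inside the sum.
⊛-assoc : ∀ f g h → (f ⊛ g) ⊛ h ≗ f ⊛ (g ⊛ h)
⊛-assoc f g h = begin
  (f ⊛ g) ⊛ h                                        ≈⟨ ⊛-comm (f ⊛ g) h ⟩
  h ⊛ (f ⊛ g)                                        ≈⟨ ⊛-congʳ h (⊛-as-sumS f g) ⟩
  h ⊛ sumS (λ j → scaleS (f j) (shiftBy j g))        ≈⟨ ⊛-sumS h _ (shifts-summable f g) ⟩
  sumS (λ j → h ⊛ scaleS (f j) (shiftBy j g))        ≈⟨ sumS-cong move-h ⟩
  sumS (λ j → scaleS (f j) (shiftBy j (h ⊛ g)))      ≈⟨ ≗-sym (⊛-as-sumS f (h ⊛ g)) ⟩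
  f ⊛ (h ⊛ g)                                        ≈⟨ ⊛-congʳ f (⊛-comm h g) ⟩
  f ⊛ (g ⊛ h)                                        ∎
  where
  open ≗-Reasoning
  move-h : ∀ j → h ⊛ scaleS (f j) (shiftBy j g) ≗ scaleS (f j) (shiftBy j (h ⊛ g))
  move-h j = ≗-trans (⊛-scale (f j) (shiftBy j g) h) (scale-cong (f j) (⊛-shiftBy j g h))

powS-cong : ∀ k {f g} → f ≗ g → powS f k ≗ powS g k
powS-cong zero    f≗g = ≗-refl
powS-cong (suc k) f≗g = ⊛-cong f≗g (powS-cong k f≗g)

powS-⊛ : ∀ k f g → powS (f ⊛ g) k ≗ powS f k ⊛ powS g k
powS-⊛ zero    f g = ≗-sym (oneS-⊛ oneS)
powS-⊛ (suc k) f g = ≗-trans (⊛-congʳ (f ⊛ g) (powS-⊛ k f g)) (interchange f g (powS f k) (powS g k))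
  where
  interchange : ∀ a b c d → (a ⊛ b) ⊛ (c ⊛ d) ≗ (a ⊛ c) ⊛ (b ⊛ d)
  interchange a b c d = begin
    (a ⊛ b) ⊛ (c ⊛ d)   ≈⟨ ⊛-assoc a b (c ⊛ d) ⟩
    a ⊛ (b ⊛ (c ⊛ d))   ≈⟨ ⊛-congʳ a (≗-sym (⊛-assoc b c d)) ⟩
    a ⊛ ((b ⊛ c) ⊛ d)   ≈⟨ ⊛-congʳ a (⊛-cong (⊛-comm b c) (≗-refl {d})) ⟩
    a ⊛ ((c ⊛ b) ⊛ d)   ≈⟨ ⊛-congʳ a (⊛-assoc c b d) ⟩
    a ⊛ (c ⊛ (b ⊛ d))   ≈⟨ ≗-sym (⊛-assoc a c (b ⊛ d)) ⟩
    (a ⊛ c) ⊛ (b ⊛ d)   ∎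
    where open ≗-Reasoning

powS-shift : ∀ k f → powS (shift f) k ≗ shiftBy k (powS f k)
powS-shift zero    f = ≗-refl
powS-shift (suc k) f =
  ≗-trans (⊛-congʳ (shift f) (powS-shift k f))
          (≗-trans (shift-⊛ f (shiftBy k (powS f k))) (shift-cong (⊛-shiftBy k (powS f k) f)))

powS-scale : ∀ k a f → powS (scaleS a f) k ≗ scaleS (a ^ℚ k) (powS f k)
powS-scale zero    a f n = sym (ℚP.*-identityˡ _)
powS-scale (suc k) a f = begin
  scaleS a f ⊛ powS (scaleS a f) k              ≈⟨ ⊛-congʳ (scaleS a f) (powS-scale k a f) ⟩
  scaleS a f ⊛ scaleS (a ^ℚ k) (powS f k)       ≈⟨ scale-⊛ a f (scaleS (a ^ℚ k) (powS f k)) ⟩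
  scaleS a (f ⊛ scaleS (a ^ℚ k) (powS f k))     ≈⟨ scale-cong a (⊛-scale (a ^ℚ k) (powS f k) f) ⟩
  scaleS a (scaleS (a ^ℚ k) (powS f (suc k)))   ≈⟨ (λ n → sym (ℚP.*-assoc a (a ^ℚ k) _)) ⟩
  scaleS (a ^ℚ suc k) (powS f (suc k))          ∎
  where open ≗-Reasoning

-- For a Riordan array of the form (d, z d) the entry (n, k) is [z^{n-k}] d^{k+1},
-- because d (z d)^k = z^k d^{k+1}.
riordan-zd : ∀ d h → h ≗ shift d → ∀ {n k} → k ≤ n →
  riordan d h n k ≡ coeff (n ∸ k) (powS d (suc k))
riordan-zd d h h≗zd {n} {k} k≤n = begin
  (d ⊛ powS h k) n                ≡⟨ ⊛-congʳ d (≗-trans (powS-cong k h≗zd) (powS-shift k d)) n ⟩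
  (d ⊛ shiftBy k (powS d k)) n    ≡⟨ ⊛-shiftBy k (powS d k) d n ⟩
  shiftBy k (powS d (suc k)) n    ≡⟨ shiftBy-coeff k (powS d (suc k)) k≤n ⟩
  powS d (suc k) (n ∸ k)          ∎
  where open ≡-Reasoning

ι : ℕ → ℚ
ι n = (ℤ.+ n) / 1

toℚᵘ-ι : ∀ n → toℚᵘ (ι n) ℚᵘ.≃ mkℚᵘ (ℤ.+ n) 0
toℚᵘ-ι n = ℚP.toℚᵘ-fromℚᵘ (mkℚᵘ (ℤ.+ n) 0)

ι-+ : ∀ a b → ι (a ℕ.+ b) ≡ ι a + ι b
ι-+ a b = ℚP.toℚᵘ-injective (ℚᵘP.≃-trans (toℚᵘ-ι (a ℕ.+ b)) (ℚᵘP.≃-sym (ℚᵘP.≃-trans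
  (ℚP.toℚᵘ-homo-+ (ι a) (ι b)) (ℚᵘP.≃-trans (ℚᵘP.+-cong (toℚᵘ-ι a) (toℚᵘ-ι b)) sum-integers))))
  where
  sum-integers : mkℚᵘ (ℤ.+ a) 0 ℚᵘ.+ mkℚᵘ (ℤ.+ b) 0 ℚᵘ.≃ mkℚᵘ (ℤ.+ (a ℕ.+ b)) 0
  sum-integers = *≡* (cong (ℤ._* ℤ.+ 1)
    (trans (cong₂ ℤ._+_ (ℤP.*-identityʳ (ℤ.+ a)) (ℤP.*-identityʳ (ℤ.+ b))) (sym (ℤP.pos-+ a b))))

ι-* : ∀ a b → ι (a ℕ.* b) ≡ ι a * ι b
ι-* a b = ℚP.toℚᵘ-injective (ℚᵘP.≃-trans (toℚᵘ-ι (a ℕ.* b)) (ℚᵘP.≃-sym (ℚᵘP.≃-trans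
  (ℚP.toℚᵘ-homo-* (ι a) (ι b)) (ℚᵘP.≃-trans (ℚᵘP.*-cong (toℚᵘ-ι a) (toℚᵘ-ι b)) product-integers))))
  where
  product-integers : mkℚᵘ (ℤ.+ a) 0 ℚᵘ.* mkℚᵘ (ℤ.+ b) 0 ℚᵘ.≃ mkℚᵘ (ℤ.+ (a ℕ.* b)) 0
  product-integers = *≡* (cong (ℤ._* ℤ.+ 1) (sym (ℤP.pos-* a b)))

ι-div : ∀ x n y → ι x ≡ y * ι (suc n) → (ℤ.+ x) / suc n ≡ y
ι-div x n y x≡y[n+1] =
  ℚP.toℚᵘ-injective (ℚᵘP.≃-trans (ℚP.toℚᵘ-fromℚᵘ (mkℚᵘ (ℤ.+ x) n)) (cross (toℚᵘ y) unnormalised))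
  where
  unnormalised : mkℚᵘ (ℤ.+ x) 0 ℚᵘ.≃ toℚᵘ y ℚᵘ.* mkℚᵘ (ℤ.+ suc n) 0
  unnormalised = ℚᵘP.≃-trans (ℚᵘP.≃-sym (toℚᵘ-ι x)) (ℚᵘP.≃-trans (ℚP.toℚᵘ-cong x≡y[n+1])
    (ℚᵘP.≃-trans (ℚP.toℚᵘ-homo-* y (ι (suc n))) (ℚᵘP.*-cong (ℚᵘP.≃-refl {toℚᵘ y}) (toℚᵘ-ι (suc n)))))
  cross : ∀ Y → mkℚᵘ (ℤ.+ x) 0 ℚᵘ.≃ Y ℚᵘ.* mkℚᵘ (ℤ.+ suc n) 0 → mkℚᵘ (ℤ.+ x) n ℚᵘ.≃ Y
  cross (mkℚᵘ p q) (*≡* eq) = *≡* (trans (cong (λ t → ℤ.+ x ℤ.* ℤ.+ t) (sym (ℕP.*-identityʳ (suc q))))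
                                        (trans eq (ℤP.*-identityʳ (p ℤ.* ℤ.+ suc n))))

Cq : ℕ → ℕ → ℚ
Cq n k = ι (n C k)

pascal : ∀ n k → Cq (suc n) (suc k) ≡ Cq n k + Cq n (suc k)
pascal n k = trans (cong ι (sym (nCk+nC[k+1]≡[n+1]C[k+1] n k))) (ι-+ (n C k) (n C suc k))

binom-sym : ∀ a b → (a ℕ.+ b) C a ≡ (a ℕ.+ b) C b
binom-sym a b = trans (nCk≡nC[n∸k] (ℕP.m≤m+n a b)) (cong ((a ℕ.+ b) C_) (ℕP.m+n∸m≡n a b))

absorb : ∀ n k → suc k ℕ.* (suc n C suc k) ≡ suc n ℕ.* (n C k)
absorb n k with k ℕ.≤? n
... | no k≰n = begin
  suc k ℕ.* (suc n C suc k)   ≡⟨ cong (suc k ℕ.*_) (k>n⇒nCk≡0 (s≤s (ℕP.≰⇒> k≰n))) ⟩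
  suc k ℕ.* 0                 ≡⟨ ℕP.*-zeroʳ (suc k) ⟩
  0                           ≡⟨ sym (ℕP.*-zeroʳ (suc n)) ⟩
  suc n ℕ.* 0                 ≡⟨ cong (suc n ℕ.*_) (sym (k>n⇒nCk≡0 (ℕP.≰⇒> k≰n))) ⟩
  suc n ℕ.* (n C k)           ∎
  where open ≡-Reasoning
... | yes k≤n = ℕP.*-cancelʳ-≡ _ _ (k ! ℕ.* (n ∸ k) !) {{k ℕP.!* (n ∸ k) !≢0}} (begin
  suc k ℕ.* (suc n C suc k) ℕ.* (k ! ℕ.* (n ∸ k) !)
    ≡⟨ regroup (suc k) (suc n C suc k) (k !) ((n ∸ k) !) ⟩
  (suc n C suc k) ℕ.* (suc k ! ℕ.* (suc n ∸ suc k) !)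
    ≡⟨ factorial-formula (s≤s k≤n) ⟩
  suc n !
    ≡⟨ cong (suc n ℕ.*_) (sym (factorial-formula k≤n)) ⟩
  suc n ℕ.* ((n C k) ℕ.* (k ! ℕ.* (n ∸ k) !))
    ≡⟨ sym (ℕP.*-assoc (suc n) (n C k) _) ⟩
  suc n ℕ.* (n C k) ℕ.* (k ! ℕ.* (n ∸ k) !) ∎)
  where
  open ≡-Reasoning
  factorial-formula : ∀ {n k} → k ≤ n → (n C k) ℕ.* (k ! ℕ.* (n ∸ k) !) ≡ n !
  factorial-formula {n} {k} k≤n = trans (cong (ℕ._* (k ! ℕ.* (n ∸ k) !)) (nCk≡n!/k![n-k]! k≤n))
    (m/n*n≡m {{k ℕP.!* (n ∸ k) !≢0}} (k![n∸k]!∣n! k≤n))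
  regroup : ∀ a b c d → a ℕ.* b ℕ.* (c ℕ.* d) ≡ b ℕ.* ((a ℕ.* c) ℕ.* d)
  regroup = solve-∀

binom-adjacent : ∀ m n → suc n ℕ.* ((suc m ℕ.+ n) C m) ≡ suc m ℕ.* ((suc m ℕ.+ n) C suc m)
binom-adjacent m n = begin
  suc n ℕ.* ((suc m ℕ.+ n) C m)      ≡⟨ cong (λ t → suc n ℕ.* (t C m)) (sym (ℕP.+-suc m n)) ⟩
  suc n ℕ.* ((m ℕ.+ suc n) C m)      ≡⟨ cong (suc n ℕ.*_) (binom-sym m (suc n)) ⟩
  suc n ℕ.* ((m ℕ.+ suc n) C suc n)  ≡⟨ cong (λ t → suc n ℕ.* (t C suc n)) (ℕP.+-suc m n) ⟩
  suc n ℕ.* (suc (m ℕ.+ n) C suc n)  ≡⟨ absorb (m ℕ.+ n) n ⟩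
  suc (m ℕ.+ n) ℕ.* ((m ℕ.+ n) C n)  ≡⟨ cong (suc (m ℕ.+ n) ℕ.*_) (sym (binom-sym m n)) ⟩
  suc (m ℕ.+ n) ℕ.* ((m ℕ.+ n) C m)  ≡⟨ sym (absorb (m ℕ.+ n) m) ⟩
  suc m ℕ.* ((suc m ℕ.+ n) C suc m)  ∎
  where open ≡-Reasoning

-- binom(i+q, q): the coefficient of uⁱ in (1-u)^{-(q+1)}.
binomWeight : ℕ → ℕ → ℚ
binomWeight q i = Cq (i ℕ.+ q) q

binomWeight-start : ∀ q → binomWeight (suc q) 0 ≡ binomWeight q 0
binomWeight-start q = trans (cong ι (nCn≡1 (suc q))) (sym (cong ι (nCn≡1 q)))

binomWeight-pascal : ∀ q i →
  binomWeight (suc q) (suc i) ≡ binomWeight q (suc i) + binomWeight (suc q) i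
binomWeight-pascal q i =
  trans (pascal (i ℕ.+ suc q) q) (cong (λ t → Cq t q + binomWeight (suc q) i) (ℕP.+-suc i q))

module Geometric (u v : Series) (u≗zv : u ≗ shift v) where

  G : Series
  G = geomS u

  -- uⁱ = zⁱ vⁱ has order at least i, so Σᵢ wᵢ uⁱ makes sense for all weights w.
  powers-summable : ∀ (w : ℕ → ℚ) → Summable (λ i → scaleS (w i) (powS u i))
  powers-summable w i = scale-order (w i) (powS u i)
    (order-cong (≗-sym (≗-trans (powS-cong i u≗zv) (powS-shift i v))) (shiftBy-order i (powS v i)))

  wsum : (ℕ → ℚ) → Series
  wsum w = sumS (λ i → scaleS (w i) (powS u i))

  wsum-cong : ∀ {w w′} → (∀ i → w i ≡ w′ i) → wsum w ≗ wsum w′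
  wsum-cong w≡w′ = sumS-cong (λ i n → cong (_* powS u i n) (w≡w′ i))

  wsum-+ : ∀ w w′ → wsum (λ i → w i + w′ i) ≗ wsum w +S wsum w′
  wsum-+ w w′ n =
    trans (sumTo-cong n (λ i _ → ℚP.*-distribʳ-+ (powS u i n) (w i) (w′ i))) (sumTo-+ n _ _)

  wsum-unfold : ∀ w → wsum w ≗ scaleS (w 0) oneS +S u ⊛ wsum (w ∘ suc)
  wsum-unfold w = ≗-trans (sumS-unfold _ (powers-summable w)) (+S-cong (≗-refl {scaleS (w 0) oneS}) (≗-sym u⊛tail))
    where
    u⊛tail : u ⊛ wsum (w ∘ suc) ≗ sumS (λ i → scaleS (w (suc i)) (powS u (suc i)))
    u⊛tail = ≗-trans (⊛-sumS u _ (powers-summable (w ∘ suc)))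
                     (sumS-cong (λ i → ⊛-scale (w (suc i)) (powS u i) u))

  wsum-pascal : ∀ w′ w → w 0 ≡ w′ 0 → (∀ i → w (suc i) ≡ w′ (suc i) + w i) →
    wsum w ≗ wsum w′ +S u ⊛ wsum w
  wsum-pascal w′ w w₀≡w′₀ recursion = begin
    wsum w
      ≈⟨ wsum-unfold w ⟩
    scaleS (w 0) oneS +S u ⊛ wsum (w ∘ suc)
      ≈⟨ +S-cong (λ n → cong (_* oneS n) w₀≡w′₀) (⊛-congʳ u (≗-trans (wsum-cong recursion) (wsum-+ (w′ ∘ suc) w))) ⟩
    scaleS (w′ 0) oneS +S u ⊛ (wsum (w′ ∘ suc) +S wsum w)
      ≈⟨ +S-cong (≗-refl {scaleS (w′ 0) oneS}) (⊛-distribˡ (wsum (w′ ∘ suc)) (wsum w) u) ⟩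
    scaleS (w′ 0) oneS +S (u ⊛ wsum (w′ ∘ suc) +S u ⊛ wsum w)
      ≈⟨ ≗-sym (+S-assoc (scaleS (w′ 0) oneS) (u ⊛ wsum (w′ ∘ suc)) (u ⊛ wsum w)) ⟩
    (scaleS (w′ 0) oneS +S u ⊛ wsum (w′ ∘ suc)) +S u ⊛ wsum w
      ≈⟨ +S-cong (≗-sym (wsum-unfold w′)) (≗-refl {u ⊛ wsum w}) ⟩
    wsum w′ +S u ⊛ wsum w
      ∎
    where open ≗-Reasoning

  -- Since u(0) = 0, the equation X = Y + u X determines X coefficient by coefficient.
  fixpoint-unique : ∀ {X X′} Y → X ≗ Y +S u ⊛ X → X′ ≗ Y +S u ⊛ X′ → X ≗ X′
  fixpoint-unique {X} {X′} Y X-fix X′-fix n = agree n n ℕP.≤-refl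
    where
    u₀-kills : ∀ a → u 0 * a ≡ 0ℚ
    u₀-kills a = trans (cong (_* a) (u≗zv 0)) (ℚP.*-zeroˡ a)

    u⊛-below : ∀ m → (∀ k → k < m → X k ≡ X′ k) → (u ⊛ X) m ≡ (u ⊛ X′) m
    u⊛-below m below = sumTo-cong m term
      where
      term : ∀ i → i ≤ m → u i * X (m ∸ i) ≡ u i * X′ (m ∸ i)
      term zero    _   = trans (u₀-kills (X m)) (sym (u₀-kills (X′ m)))
      term (suc i) i<m = cong (u (suc i) *_) (below (m ∸ suc i) (ℕP.∸-monoʳ-< (s≤s z≤n) i<m))

    agree : ∀ n m → m ≤ n → X m ≡ X′ m
    below : ∀ n {m} → m ≤ n → ∀ k → k < m → X k ≡ X′ k
    agree n m m≤n = trans (X-fix m) (trans (cong (Y m +_) (u⊛-below m (below n m≤n))) (sym (X′-fix m)))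
    below zero    z≤n k ()
    below (suc n) m≤n k k<m = agree n k (ℕP.≤-pred (ℕP.≤-trans k<m m≤n))

  -- G = Σᵢ uⁱ (all weights binom(i, 0) = 1), hence G = 1 + u G.
  geomS-wsum : G ≗ wsum (binomWeight 0)
  geomS-wsum n = sumTo-cong n (λ i _ → sym (ℚP.*-identityˡ (powS u i n)))

  geomS-mul : ∀ P → G ⊛ P ≗ P +S u ⊛ (G ⊛ P)
  geomS-mul P = begin
    G ⊛ P                         ≈⟨ ⊛-cong G-fix (≗-refl {P}) ⟩
    (oneS +S u ⊛ G) ⊛ P           ≈⟨ ⊛-distribʳ oneS (u ⊛ G) P ⟩
    oneS ⊛ P +S (u ⊛ G) ⊛ P       ≈⟨ +S-cong (oneS-⊛ P) (⊛-assoc u G P) ⟩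
    P +S u ⊛ (G ⊛ P)              ∎
    where
    open ≗-Reasoning
    G-fix : G ≗ oneS +S u ⊛ G
    G-fix = ≗-trans geomS-wsum (≗-trans (wsum-unfold (binomWeight 0))
              (+S-cong (scale-one oneS) (⊛-congʳ u (≗-sym geomS-wsum))))

  powS-geomS : ∀ q → powS G (suc q) ≗ wsum (binomWeight q)
  powS-geomS zero    = ≗-trans (⊛-oneS G) geomS-wsum
  powS-geomS (suc q) = fixpoint-unique (wsum (binomWeight q))
    (≗-trans (geomS-mul (powS G (suc q))) (+S-cong (powS-geomS q) ≗-refl))
    (wsum-pascal (binomWeight q) (binomWeight (suc q)) (binomWeight-start q) (binomWeight-pascal q))

Cq₋ : ℕ → ℕ → ℚ
Cq₋ n zero    = 0ℚ
Cq₋ n (suc k) = Cq n k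

-- The ballot numbers binom(2m+j, m) - binom(2m+j, m-1); they turn out to be
-- the coefficients [z^m] c^{j+1}.
ballot : ℕ → ℕ → ℚ
ballot m j = Cq (m ℕ.+ m ℕ.+ j) m - Cq₋ (m ℕ.+ m ℕ.+ j) m

ballot-at : ∀ m j {N} → m ℕ.+ m ℕ.+ j ≡ N → ballot m j ≡ Cq N m - Cq₋ N m
ballot-at m j m+m+j≡N = cong (λ N → Cq N m - Cq₋ N m) m+m+j≡N

difference-pascal : ∀ N m →
  Cq (suc N) (suc m) - Cq (suc N) m ≡ (Cq N (suc m) - Cq N m) + (Cq N m - Cq₋ N m)
difference-pascal N m = begin
  Cq (suc N) (suc m) - Cq (suc N) m               ≡⟨ cong₂ _-_ (pascal N m) (pascal₋ m) ⟩
  (Cq N m + Cq N (suc m)) - (Cq₋ N m + Cq N m)    ≡⟨ regroup (Cq N m) (Cq N (suc m)) (Cq₋ N m) ⟩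
  (Cq N (suc m) - Cq N m) + (Cq N m - Cq₋ N m)    ∎
  where
  open ≡-Reasoning
  pascal₋ : ∀ m → Cq (suc N) m ≡ Cq₋ N m + Cq N m
  pascal₋ zero    = refl
  pascal₋ (suc m) = pascal N m
  regroup : ∀ a b c → (a + b) - (c + a) ≡ (b - a) + (a - c)
  regroup = solve 3 (λ a b c → (a :+ b) :- (c :+ a) := (b :- a) :+ (a :- c)) refl

-- The recursion behind c^{j+2} = c^{j+1} + z c^{j+3} (in degree m+1).
ballot-step : ∀ m j → ballot (suc m) (suc j) ≡ ballot (suc m) j + ballot m (suc (suc j))
ballot-step m j = begin
  ballot (suc m) (suc j)                                ≡⟨ ballot-at (suc m) (suc j) (shape₁ m j) ⟩
  Cq (suc N) (suc m) - Cq (suc N) m                     ≡⟨ difference-pascal N m ⟩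
  (Cq N (suc m) - Cq N m) + (Cq N m - Cq₋ N m)          ≡⟨ cong (ballot (suc m) j +_) (sym (ballot-at m (suc (suc j)) (shape₂ m j))) ⟩
  ballot (suc m) j + ballot m (suc (suc j))             ∎
  where
  open ≡-Reasoning
  N : ℕ
  N = suc m ℕ.+ suc m ℕ.+ j
  shape₁ : ∀ m j → suc m ℕ.+ suc m ℕ.+ suc j ≡ suc (suc m ℕ.+ suc m ℕ.+ j)
  shape₁ = solve-∀
  shape₂ : ∀ m j → m ℕ.+ m ℕ.+ suc (suc j) ≡ suc m ℕ.+ suc m ℕ.+ j
  shape₂ = solve-∀

-- The recursion behind c = 1 + z c² (in degree m+1); it uses the symmetry of binomials.
ballot-base : ∀ m → ballot (suc m) 0 ≡ 0ℚ + ballot m 1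
ballot-base m = begin
  ballot (suc m) 0                                ≡⟨ ballot-at (suc m) 0 (shape m) ⟩
  Cq (suc N) (suc m) - Cq (suc N) m               ≡⟨ difference-pascal N m ⟩
  (Cq N (suc m) - Cq N m) + ballot m 1            ≡⟨ cong (λ x → (x - Cq N m) + ballot m 1) middle-symmetric ⟩
  (Cq N m - Cq N m) + ballot m 1                  ≡⟨ cong (_+ ballot m 1) (ℚP.+-inverseʳ (Cq N m)) ⟩
  0ℚ + ballot m 1                                 ∎
  where
  open ≡-Reasoning
  N : ℕ
  N = m ℕ.+ m ℕ.+ 1
  shape : ∀ m → suc m ℕ.+ suc m ℕ.+ 0 ≡ suc (m ℕ.+ m ℕ.+ 1)
  shape = solve-∀
  middle-symmetric : Cq N (suc m) ≡ Cq N m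
  middle-symmetric = trans (cong (λ t → Cq t (suc m)) (ℕP.+-comm (m ℕ.+ m) 1))
    (trans (cong ι (binom-sym (suc m) m)) (cong (λ t → Cq t m) (ℕP.+-comm 1 (m ℕ.+ m))))

lower-neighbour : ∀ m j → Cq₋ (m ℕ.+ m ℕ.+ j) m * ι (suc (m ℕ.+ j)) ≡ ι m * Cq (m ℕ.+ m ℕ.+ j) m
lower-neighbour zero    j = trans (ℚP.*-zeroˡ (ι (suc j))) (sym (ℚP.*-zeroˡ (Cq j 0)))
lower-neighbour (suc m) j = begin
  Cq W m * ι (suc (suc (m ℕ.+ j)))       ≡⟨ ℚP.*-comm (Cq W m) _ ⟩
  ι (suc (suc (m ℕ.+ j))) * Cq W m       ≡⟨ sym (ι-* (suc (suc (m ℕ.+ j))) (W C m)) ⟩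
  ι (suc (suc (m ℕ.+ j)) ℕ.* (W C m))    ≡⟨ cong ι adjacent ⟩
  ι (suc m ℕ.* (W C suc m))              ≡⟨ ι-* (suc m) (W C suc m) ⟩
  ι (suc m) * Cq W (suc m)               ∎
  where
  open ≡-Reasoning
  W : ℕ
  W = suc m ℕ.+ suc m ℕ.+ j
  adjacent : suc (suc (m ℕ.+ j)) ℕ.* (W C m) ≡ suc m ℕ.* (W C suc m)
  adjacent = subst (λ t → suc (suc (m ℕ.+ j)) ℕ.* (t C m) ≡ suc m ℕ.* (t C suc m))
                   (cong suc (sym (ℕP.+-assoc m (suc m) j)))
                   (binom-adjacent m (suc (m ℕ.+ j)))

ballot-closed : ∀ m j → ι (suc j) * Cq (m ℕ.+ m ℕ.+ j) m ≡ ballot m j * ι (suc (m ℕ.+ j))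
ballot-closed m j = begin
  s * b                            ≡⟨ split-off s b (ι m) ⟩
  b * (ι m + s) - ι m * b          ≡⟨ cong (b * (ι m + s) -_) (sym b₋-ratio) ⟩
  b * (ι m + s) - b₋ * (ι m + s)   ≡⟨ factor b b₋ (ι m + s) ⟩
  (b - b₋) * (ι m + s)             ≡⟨ cong ((b - b₋) *_) (sym size) ⟩
  ballot m j * ι (suc (m ℕ.+ j))   ∎
  where
  open ≡-Reasoning
  b b₋ s : ℚ
  b  = Cq (m ℕ.+ m ℕ.+ j) m
  b₋ = Cq₋ (m ℕ.+ m ℕ.+ j) m
  s  = ι (suc j)
  size : ι (suc (m ℕ.+ j)) ≡ ι m + s
  size = trans (cong ι (sym (ℕP.+-suc m j))) (ι-+ m (suc j))
  b₋-ratio : b₋ * (ι m + s) ≡ ι m * b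
  b₋-ratio = trans (cong (b₋ *_) (sym size)) (lower-neighbour m j)
  split-off : ∀ s b x → s * b ≡ b * (x + s) - x * b
  split-off = solve 3 (λ s b x → s :* b := b :* (x :+ s) :- x :* b) refl
  factor : ∀ b b₋ y → b * y - b₋ * y ≡ (b - b₋) * y
  factor = solve 3 (λ b b₋ y → b :* y :- b₋ :* y := (b :- b₋) :* y) refl

-- The series that will be identified with c^j (see powS-catalan).
ballotS : ℕ → Series
ballotS zero      = oneS
ballotS (suc j) m = ballot m j

ballotS-constant : ∀ j → ballotS j 0 ≡ 1ℚ
ballotS-constant zero    = refl
ballotS-constant (suc j) = refl

ballotS-step : ∀ j → ballotS (suc j) ≗ ballotS j +S shift (ballotS (suc (suc j)))
ballotS-step j       zero    = sym (trans (ℚP.+-identityʳ (ballotS j 0)) (ballotS-constant j))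
ballotS-step zero    (suc m) = ballot-base m
ballotS-step (suc j) (suc m) = ballot-step m j

ballotS-⊛ : ∀ j l → ballotS j ⊛ ballotS l ≗ ballotS (j ℕ.+ l)
ballotS-⊛ j l m = product m j
  where
  product : ∀ m j → (ballotS j ⊛ ballotS l) m ≡ ballotS (j ℕ.+ l) m
  product m       zero    = oneS-⊛ (ballotS l) m
  product zero    (suc j) = trans (cong (1ℚ *_) (ballotS-constant l)) (sym (ballotS-constant (suc j ℕ.+ l)))
  product (suc m) (suc j) = begin
    (ballotS (suc j) ⊛ ballotS l) (suc m)
      ≡⟨ ⊛-cong (ballotS-step j) (≗-refl {ballotS l}) (suc m) ⟩
    ((ballotS j +S shift (ballotS (suc (suc j)))) ⊛ ballotS l) (suc m)
      ≡⟨ ⊛-distribʳ (ballotS j) (shift (ballotS (suc (suc j)))) (ballotS l) (suc m) ⟩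
    (ballotS j ⊛ ballotS l) (suc m) + (shift (ballotS (suc (suc j))) ⊛ ballotS l) (suc m)
      ≡⟨ cong ((ballotS j ⊛ ballotS l) (suc m) +_) (shift-⊛ (ballotS (suc (suc j))) (ballotS l) (suc m)) ⟩
    (ballotS j ⊛ ballotS l) (suc m) + (ballotS (suc (suc j)) ⊛ ballotS l) m
      ≡⟨ cong₂ _+_ (product (suc m) j) (product m (suc (suc j))) ⟩
    ballotS (j ℕ.+ l) (suc m) + ballotS (suc (suc (j ℕ.+ l))) m
      ≡⟨ sym (ballotS-step (j ℕ.+ l) (suc m)) ⟩
    ballotS (suc j ℕ.+ l) (suc m)
      ∎
    where open ≡-Reasoning

catalan-ballot : cS ≗ ballotS 1
catalan-ballot m = ι-div ((2 ℕ.* m) C m) m (ballot m 0) (begin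
  ι ((2 ℕ.* m) C m)              ≡⟨ cong (λ t → Cq t m) (twice m) ⟩
  Cq (m ℕ.+ m ℕ.+ 0) m           ≡⟨ sym (ℚP.*-identityˡ _) ⟩
  ι 1 * Cq (m ℕ.+ m ℕ.+ 0) m     ≡⟨ ballot-closed m 0 ⟩
  ballot m 0 * ι (suc (m ℕ.+ 0)) ≡⟨ cong (λ t → ballot m 0 * ι (suc t)) (ℕP.+-identityʳ m) ⟩
  ballot m 0 * ι (suc m)         ∎)
  where
  open ≡-Reasoning
  twice : ∀ m → 2 ℕ.* m ≡ m ℕ.+ m ℕ.+ 0
  twice = solve-∀

powS-catalan : ∀ j → powS cS j ≗ ballotS j
powS-catalan zero    = ≗-refl
powS-catalan (suc j) = ≗-trans (⊛-cong catalan-ballot (powS-catalan j)) (ballotS-⊛ 1 j)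

module CatalanRiordan (r : ℚ) where

  -- u = r z c; in particular u = z v with v = r c, so the geometric series applies.
  rzc-scale : rzc r ≗ scaleS r (shift cS)
  rzc-scale = scale-cong r (zS-⊛ cS)

  rzc-shift : rzc r ≗ shift (scaleS r cS)
  rzc-shift = ≗-trans rzc-scale scale-shift
    where
    scale-shift : scaleS r (shift cS) ≗ shift (scaleS r cS)
    scale-shift zero    = ℚP.*-zeroʳ r
    scale-shift (suc n) = refl

  open Geometric (rzc r) (scaleS r cS) rzc-shift public

  hS-shift : hS r ≗ shift (dS r)
  hS-shift = ≗-trans (⊛-cong (zS-⊛ cS) (≗-refl {G})) (shift-⊛ cS G)

  powS-rzc : ∀ i → powS (rzc r) i ≗ scaleS (r ^ℚ i) (shiftBy i (ballotS i))
  powS-rzc i = ≗-trans (powS-cong i rzc-scale) (≗-trans (powS-scale i r (shift cS))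
    (scale-cong (r ^ℚ i) (≗-trans (powS-shift i cS) (shiftBy-cong i (powS-catalan i)))))

  catalan-rzc : ∀ k i →
    ballotS (suc k) ⊛ powS (rzc r) i ≗ scaleS (r ^ℚ i) (shiftBy i (ballotS (suc k ℕ.+ i)))
  catalan-rzc k i = ≗-trans (⊛-congʳ (ballotS (suc k)) (powS-rzc i))
    (≗-trans (⊛-scale (r ^ℚ i) (shiftBy i (ballotS i)) (ballotS (suc k)))
    (scale-cong (r ^ℚ i) (≗-trans (⊛-shiftBy i (ballotS i) (ballotS (suc k)))
                                  (shiftBy-cong i (ballotS-⊛ (suc k) i)))))

  powS-dS : ∀ k → powS (dS r) (suc k) ≗
    sumS (λ i → scaleS (binomWeight k i) (scaleS (r ^ℚ i) (shiftBy i (ballotS (suc k ℕ.+ i)))))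
  powS-dS k = begin
    powS (dS r) (suc k)                         ≈⟨ powS-⊛ (suc k) cS G ⟩
    powS cS (suc k) ⊛ powS G (suc k)            ≈⟨ ⊛-cong (powS-catalan (suc k)) (powS-geomS k) ⟩
    ballotS (suc k) ⊛ wsum (binomWeight k)      ≈⟨ ⊛-sumS (ballotS (suc k)) _ (powers-summable (binomWeight k)) ⟩
    sumS (λ i → ballotS (suc k) ⊛ scaleS (binomWeight k i) (powS (rzc r) i))
      ≈⟨ sumS-cong (λ i → ≗-trans (⊛-scale (binomWeight k i) (powS (rzc r) i) (ballotS (suc k)))
                                  (scale-cong (binomWeight k i) (catalan-rzc k i))) ⟩
    sumS (λ i → scaleS (binomWeight k i) (scaleS (r ^ℚ i) (shiftBy i (ballotS (suc k ℕ.+ i)))))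
      ∎
    where open ≗-Reasoning

  powS-dS-coeff : ∀ k p →
    coeff p (powS (dS r) (suc k)) ≡ sumTo p (λ i → binomWeight k i * (r ^ℚ i * ballot (p ∸ i) (k ℕ.+ i)))
  powS-dS-coeff k p = trans (powS-dS k p) (sumTo-cong p (λ i i≤p →
    cong (λ x → binomWeight k i * (r ^ℚ i * x)) (shiftBy-coeff i (ballotS (suc k ℕ.+ i)) i≤p)))

closedTerm : ℚ → ℕ → ℕ → ℕ → ℚ
closedTerm r n k i =
  ((ℤ.+ ((i ℕ.+ k ℕ.+ 1) ℕ.* (((2 ℕ.* n) ∸ (i ℕ.+ k)) C n) ℕ.* ((i ℕ.+ k) C k))) / suc n) * (r ^ℚ i)

ballot-closed-reindexed : ∀ k i M →
  ι (i ℕ.+ k ℕ.+ 1) * Cq ((2 ℕ.* (k ℕ.+ i ℕ.+ M)) ∸ (i ℕ.+ k)) (k ℕ.+ i ℕ.+ M)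
    ≡ ballot M (k ℕ.+ i) * ι (suc (k ℕ.+ i ℕ.+ M))
ballot-closed-reindexed k i M = begin
  ι (i ℕ.+ k ℕ.+ 1) * Cq ((2 ℕ.* n) ∸ (i ℕ.+ k)) n  ≡⟨ cong₂ _*_ (cong ι (weight k i)) upper ⟩
  ι (suc (k ℕ.+ i)) * Cq W M                        ≡⟨ ballot-closed M (k ℕ.+ i) ⟩
  ballot M (k ℕ.+ i) * ι (suc (M ℕ.+ (k ℕ.+ i)))    ≡⟨ cong (λ t → ballot M (k ℕ.+ i) * ι t) (size k i M) ⟩
  ballot M (k ℕ.+ i) * ι (suc n)                    ∎
  where
  open ≡-Reasoning
  n W : ℕ
  n = k ℕ.+ i ℕ.+ M
  W = M ℕ.+ M ℕ.+ (k ℕ.+ i)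
  twice-n : ∀ k i M → 2 ℕ.* (k ℕ.+ i ℕ.+ M) ≡ (i ℕ.+ k) ℕ.+ (M ℕ.+ M ℕ.+ (k ℕ.+ i))
  twice-n = solve-∀
  W≡M+n : ∀ k i M → M ℕ.+ M ℕ.+ (k ℕ.+ i) ≡ M ℕ.+ (k ℕ.+ i ℕ.+ M)
  W≡M+n = solve-∀
  size : ∀ k i M → suc (M ℕ.+ (k ℕ.+ i)) ≡ suc (k ℕ.+ i ℕ.+ M)
  size = solve-∀
  weight : ∀ k i → i ℕ.+ k ℕ.+ 1 ≡ suc (k ℕ.+ i)
  weight = solve-∀
  upper : Cq ((2 ℕ.* n) ∸ (i ℕ.+ k)) n ≡ Cq W M
  upper = begin
    Cq ((2 ℕ.* n) ∸ (i ℕ.+ k)) n        ≡⟨ cong (λ t → Cq (t ∸ (i ℕ.+ k)) n) (twice-n k i M) ⟩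
    Cq ((i ℕ.+ k) ℕ.+ W ∸ (i ℕ.+ k)) n  ≡⟨ cong (λ t → Cq t n) (ℕP.m+n∸m≡n (i ℕ.+ k) W) ⟩
    Cq W n                              ≡⟨ cong (λ t → Cq t n) (W≡M+n k i M) ⟩
    Cq (M ℕ.+ n) n                      ≡⟨ cong ι (sym (binom-sym M n)) ⟩
    Cq (M ℕ.+ n) M                      ≡⟨ cong (λ t → Cq t M) (sym (W≡M+n k i M)) ⟩
    Cq W M                              ∎

closedTerm-ballot : ∀ r k i M →
  closedTerm r (k ℕ.+ i ℕ.+ M) k i ≡ binomWeight k i * (r ^ℚ i * ballot M (k ℕ.+ i))
closedTerm-ballot r k i M = begin
  ((ℤ.+ (a ℕ.* B ℕ.* ((i ℕ.+ k) C k))) / suc n) * r ^ℚ i  ≡⟨ cong (_* r ^ℚ i) (ι-div (a ℕ.* B ℕ.* ((i ℕ.+ k) C k)) n (w * b) numerator) ⟩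
  (w * b) * r ^ℚ i                                       ≡⟨ rearrange w b (r ^ℚ i) ⟩
  w * (r ^ℚ i * b)                                       ∎
  where
  open ≡-Reasoning
  n a B : ℕ
  n = k ℕ.+ i ℕ.+ M
  a = i ℕ.+ k ℕ.+ 1
  B = ((2 ℕ.* n) ∸ (i ℕ.+ k)) C n
  w b : ℚ
  w = binomWeight k i
  b = ballot M (k ℕ.+ i)
  reorder : ∀ x y z → (x * y) * z ≡ (z * x) * y
  reorder = solve 3 (λ x y z → (x :* y) :* z := (z :* x) :* y) refl
  rearrange : ∀ x y z → (x * y) * z ≡ x * (z * y)
  rearrange = solve 3 (λ x y z → (x :* y) :* z := x :* (z :* y)) refl
  numerator : ι (a ℕ.* B ℕ.* ((i ℕ.+ k) C k)) ≡ (w * b) * ι (suc n)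
  numerator = begin
    ι (a ℕ.* B ℕ.* ((i ℕ.+ k) C k))   ≡⟨ ι-* (a ℕ.* B) ((i ℕ.+ k) C k) ⟩
    ι (a ℕ.* B) * w                   ≡⟨ cong (_* w) (ι-* a B) ⟩
    (ι a * ι B) * w                   ≡⟨ cong (_* w) (ballot-closed-reindexed k i M) ⟩
    (b * ι (suc n)) * w               ≡⟨ reorder b (ι (suc n)) w ⟩
    (w * b) * ι (suc n)               ∎

lemma5 : (r : ℚ) (n k : ℕ) → k ≤ n →
    (Cr r n k ≡ coeff (n ∸ k) (powS (dS r) (suc k))) × (Cr r n k ≡ closedForm r n k)
lemma5 r n k k≤n = entry , trans entry expansion
  where
  open CatalanRiordan r

  entry : Cr r n k ≡ coeff (n ∸ k) (powS (dS r) (suc k))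
  entry = riordan-zd (dS r) (hS r) hS-shift k≤n

  decompose : ∀ i → i ≤ n ∸ k → k ℕ.+ i ℕ.+ (n ∸ k ∸ i) ≡ n
  decompose i i≤n-k =
    trans (ℕP.+-assoc k i _) (trans (cong (k ℕ.+_) (ℕP.m+[n∸m]≡n i≤n-k)) (ℕP.m+[n∸m]≡n k≤n))

  summand : ∀ i → i ≤ n ∸ k →
    binomWeight k i * (r ^ℚ i * ballot (n ∸ k ∸ i) (k ℕ.+ i)) ≡ closedTerm r n k i
  summand i i≤n-k = subst (λ m → binomWeight k i * (r ^ℚ i * ballot (n ∸ k ∸ i) (k ℕ.+ i)) ≡ closedTerm r m k i)
                          (decompose i i≤n-k) (sym (closedTerm-ballot r k i (n ∸ k ∸ i)))

  expansion : coeff (n ∸ k) (powS (dS r) (suc k)) ≡ closedForm r n k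
  expansion = trans (powS-dS-coeff k (n ∸ k)) (sumTo-cong (n ∸ k) summand)
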